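{- For every $n\ge1$, $\gamma_e(P_n)\ge\left\lceil\frac{n+1}{2}\right\rceil$.
   Context: $P_n$ is the path on $n$ vertices $[x_1,\dots,x_n]$ with edges $\{x_i,x_{i+1}\}$. For a graph $\Gamma=(V,E)$ with distance $d$: a vertex $v$ carrying a positive integer label $\ell$ dominates exactly the vertices $u$ with $d(u,v)=\ell$; a vertex carrying label $0$ dominates only itself. An extended irregular dominating set is a set $S\subseteq V$ with an injective labeling $\lambda:S\to\{0,1,2,\dots\}$ such that every vertex of $V$ is dominated by some vertex of $S$, where some vertex of $S$ has label $0$. $\gamma_e(\Gamma)$ is the minimum cardinality of such a set (taken to be $+\infty$ if none exists). -}

module Defs where

open import Data.Nat using (ℕ; ∣_-_∣)
open import Data.Fin using (Fin; toℕ)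
open import Data.Product using (_×_; proj₁; proj₂; Σ; _,_)
open import Data.List using (List; map; length)
open import Data.List.Relation.Unary.Unique.Propositional using (Unique)
open import Data.List.Relation.Unary.Any using (Any)
open import Data.List.Membership.Propositional using (_∈_)
open import Relation.Binary.PropositionalEquality using (_≡_)

-- The path P_n on vertices Fin n (x_{i+1} ↦ i), edges {i, i+1}.
-- Graph distance in P_n.
dist : {n : ℕ} → Fin n → Fin n → ℕ
dist i j = ∣ toℕ i - toℕ j ∣

-- A labelled vertex (v , ℓ) dominates u:
--   ℓ = 0 : u = v ;  ℓ > 0 : d(u,v) = ℓ.
-- In P_n, d(u,v) = 0 iff u = v, so both cases are d(u,v) = ℓ.
Dominates : {n : ℕ} → Fin n × ℕ → Fin n → Set
Dominates (v , ℓ) u = dist u v ≡ ℓ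

-- An extended irregular dominating set of P_n, given as a list of
-- (vertex, label) pairs: vertices distinct (S is a set, λ a function on S),
-- labels distinct (λ injective), some label is 0, every vertex dominated.
record ExtIrrDomSet (n : ℕ) : Set where
  field
    elems       : List (Fin n × ℕ)
    vertsUnique : Unique (map proj₁ elems)
    labelsInj   : Unique (map proj₂ elems)
    hasZero     : Any (λ p → proj₂ p ≡ 0) elems
    dominating  : (u : Fin n) → Any (λ p → Dominates p u) elems

card : {n : ℕ} → ExtIrrDomSet n → ℕ
card S = length (ExtIrrDomSet.elems S)

-- A vertex v with label ℓ dominates in P_n at most the two vertices v ± ℓ, one on each
-- side of v, and the vertex with label 0 dominates only v itself.  So sending each vertex
-- u to the pair (a dominator of u, the side of u) is injective into S × {left, right} and
-- misses (the label-0 vertex, right): n ≤ 2|S| − 1.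
module Submission where

open import Defs
open import Data.Nat using (ℕ; _≤_; _≥_; ⌈_/2⌉; suc; zero; _*_; ∣_-_∣; _≤?_)
open import Data.Nat.Properties
  using (⌈n/2⌉-mono; ∸-cancelˡ-≡; ∸-cancelʳ-≡; m≤n⇒∣m-n∣≡n∸m; m≤n⇒∣n-m∣≡n∸m;
         ∣m-n∣≡0⇒m≡n; ≤-reflexive; ≰⇒≥; module ≤-Reasoning)
open import Data.Fin as Fin using (Fin; toℕ; combine)
open import Data.Fin.Patterns using (0F; 1F)
open import Data.Fin.Properties using (toℕ-injective; combine-injective; injective⇒≤)
open import Data.Product using (_×_; proj₂; _,_)
open import Data.List using (List; length; lookup)
open import Data.List.Relation.Unary.Any as Any using (Any)
open import Data.List.Relation.Unary.Any.Properties using (lookup-index)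
open import Function.Definitions using (Injective)
open import Relation.Binary.PropositionalEquality using (_≡_; _≢_; refl; sym; trans; cong)
open import Relation.Nullary using (yes; no; contradiction)

side : ℕ → ℕ → Fin 2
side a c with a ≤? c
... | yes _ = 0F
... | no _  = 1F

∣-∣-injective-on-side : ∀ {a b c} → side a c ≡ side b c → ∣ a - c ∣ ≡ ∣ b - c ∣ → a ≡ b
∣-∣-injective-on-side {a} {b} {c} same-side eq with a ≤? c | b ≤? c | same-side
... | yes a≤c | yes b≤c | _ =
  ∸-cancelˡ-≡ a≤c b≤c (trans (sym (m≤n⇒∣m-n∣≡n∸m a≤c)) (trans eq (m≤n⇒∣m-n∣≡n∸m b≤c)))
... | no a≰c  | no b≰c  | _ =
  ∸-cancelʳ-≡ (≰⇒≥ a≰c) (≰⇒≥ b≰c)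
    (trans (sym (m≤n⇒∣n-m∣≡n∸m (≰⇒≥ a≰c))) (trans eq (m≤n⇒∣n-m∣≡n∸m (≰⇒≥ b≰c))))

∣-∣≡0⇒side≡0F : ∀ {a c} → ∣ a - c ∣ ≡ 0 → side a c ≡ 0F
∣-∣≡0⇒side≡0F {a} {c} eq with a ≤? c
... | yes _    = refl
... | no a≰c = contradiction (≤-reflexive (∣m-n∣≡0⇒m≡n eq)) a≰c

sideOf : ∀ {n} → Fin n → Fin n × ℕ → Fin 2
sideOf u (v , _) = side (toℕ u) (toℕ v)

dominated-on-same-side⇒≡ : ∀ {n} {p : Fin n × ℕ} {u w : Fin n} →
  Dominates p u → Dominates p w → sideOf u p ≡ sideOf w p → u ≡ w
dominated-on-same-side⇒≡ du dw same-side =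
  toℕ-injective (∣-∣-injective-on-side same-side (trans du (sym dw)))

dominated-by-label-0⇒side≡0F : ∀ {n} {p : Fin n × ℕ} {u : Fin n} →
  proj₂ p ≡ 0 → Dominates p u → sideOf u p ≡ 0F
dominated-by-label-0⇒side≡0F ℓ≡0 du = ∣-∣≡0⇒side≡0F (trans du ℓ≡0)

module _ {n : ℕ} (xs : List (Fin n × ℕ))
         (hasZero : Any (λ p → proj₂ p ≡ 0) xs)
         (dominating : (u : Fin n) → Any (λ p → Dominates p u) xs) where

  private
    dominator : Fin n → Fin (length xs)
    dominator u = Any.index (dominating u)

    dominator-dominates : (u : Fin n) → Dominates (lookup xs (dominator u)) u
    dominator-dominates u = lookup-index (dominating u)

    code : Fin n → Fin (length xs * 2)
    code u = combine (dominator u) (sideOf u (lookup xs (dominator u)))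

    code-injective : Injective _≡_ _≡_ code
    code-injective {u} {w} eq
      with dominator u | dominator-dominates u | dominator w | dominator-dominates w
         | combine-injective (dominator u) _ (dominator w) _ eq
    ... | i | du | .i | dw | refl , same-side = dominated-on-same-side⇒≡ du dw same-side

    missed : Fin (length xs * 2)
    missed = combine (Any.index hasZero) 1F

    code≢missed : ∀ u → code u ≢ missed
    code≢missed u eq
      with dominator u | dominator-dominates u | combine-injective (dominator u) _ _ _ eq
    ... | _ | du | refl , side≡1F with () ←
      trans (sym side≡1F) (dominated-by-label-0⇒side≡0F (lookup-index hasZero) du)

    code⁺ : Fin (suc n) → Fin (length xs * 2)
    code⁺ 0F          = missed
    code⁺ (Fin.suc u) = code u

    code⁺-injective : Injective _≡_ _≡_ code⁺
    code⁺-injective {0F}        {0F}        _  = refl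
    code⁺-injective {0F}        {Fin.suc w} eq = contradiction (sym eq) (code≢missed w)
    code⁺-injective {Fin.suc u} {0F}        eq = contradiction eq (code≢missed u)
    code⁺-injective {Fin.suc u} {Fin.suc w} eq = cong Fin.suc (code-injective eq)

  dominating-list-length : suc n ≤ length xs * 2
  dominating-list-length = injective⇒≤ code⁺-injective

⌈m*2/2⌉≡m : ∀ m → ⌈ m * 2 /2⌉ ≡ m
⌈m*2/2⌉≡m zero    = refl
⌈m*2/2⌉≡m (suc m) = cong suc (⌈m*2/2⌉≡m m)

lemma5p6 : (n : ℕ) → n ≥ 1 → (S : ExtIrrDomSet n) → ⌈ suc n /2⌉ ≤ card S
lemma5p6 n _ S = begin
  ⌈ suc n /2⌉       ≤⟨ ⌈n/2⌉-mono (dominating-list-length elems hasZero dominating) ⟩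
  ⌈ card S * 2 /2⌉  ≡⟨ ⌈m*2/2⌉≡m (card S) ⟩
  card S            ∎
  where
  open ExtIrrDomSet S
  open ≤-Reasoning
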